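{- If $G$ is a connected graph on $n$ vertices, then $\mathrm{th}_{\mathrm{H}}(G)\geq \lceil 2\sqrt{n-1}\rceil$.
   Context: All graphs are finite, simple and undirected; $N(v)$ is the open neighborhood of $v$. Vertices are colored blue or white. Under the hopping color change rule, a blue vertex $v$ may force a white vertex $w$ (not necessarily adjacent to $v$) to become blue provided $v$ has not previously performed a force and every vertex of $N(v)$ is blue. Starting from an initial blue set $B\subseteq V(G)$, a chronological list of forces is a sequence of valid forces performed one at a time until no further force is possible; its unordered set of forces is a set of forces of $B$. $B$ is a hopping forcing set if some chronological list turns every vertex blue. For a set of forces $\mathcal F$ of $B$, put $\mathcal F^{(0)}=B$ and, for $t>0$, let $\mathcal F^{(t)}$ be the set of vertices $w$ for which there is a force $v\to w$ in $\mathcal F$ with $v\in\bigcup_{i<t}\mathcal F^{(i)}$ that is a valid hopping force when exactly the vertices of $\bigcup_{i<t}\mathcal F^{(i)}$ are blue. $\mathrm{pt}_{\mathrm{H}}(G;\mathcal F)$ is the least $t$ with $\bigcup_{i\le t}\mathcal F^{(i)}=V(G)$, and $\mathrm{pt}_{\mathrm{H}}(G;B)$ is the minimum of $\mathrm{pt}_{\mathrm{H}}(G;\mathcal F)$ over sets of forces $\mathcal F$ of $B$ ($\infty$ if $B$ is not a hopping forcing set). The hopping throttling number is $\mathrm{th}_{\mathrm{H}}(G)=\min_{B\subseteq V(G)}\big(|B|+\mathrm{pt}_{\mathrm{H}}(G;B)\big)$. -}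

module Defs where

open import Data.Nat using (ℕ; zero; suc; _+_; _*_; _≤_)
open import Data.Fin using (Fin)
open import Data.Fin.Subset as S using (Subset; ⁅_⁆; _∪_; ∣_∣)
open import Data.List using (List; []; _∷_)
open import Data.List.Membership.Propositional as L using ()
open import Data.Product using (Σ; ∃; _×_; _,_)
open import Data.Sum using (_⊎_)
open import Relation.Nullary using (¬_)
open import Relation.Binary.PropositionalEquality using (_≡_)

record Graph (n : ℕ) : Set₁ where
  field
    Adj      : Fin n → Fin n → Set
    symmetric : ∀ {u v} → Adj u v → Adj v u
    irreflexive : ∀ {u} → ¬ Adj u u
open Graph public

data Walk {n : ℕ} (G : Graph n) : Fin n → Fin n → Set where
  here : ∀ {u} → Walk G u u
  step : ∀ {u v w} → Adj G u v → Walk G v w → Walk G u w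

Connected : {n : ℕ} → Graph n → Set
Connected G = ∀ u v → Walk G u v

-- Hopping force v → w is valid when the blue set is S and the vertices in
-- `used` have already performed a force.
CanForce : {n : ℕ} → Graph n → Subset n → List (Fin n) → Fin n → Fin n → Set
CanForce G S used v w =
  (v S.∈ S) × (w S.∉ S) × (¬ (v L.∈ used)) × (∀ u → Adj G v u → u S.∈ S)

data Chron {n : ℕ} (G : Graph n) : Subset n → List (Fin n) → List (Fin n × Fin n) → Set where
  done  : ∀ {S used} → ¬ (∃ λ v → ∃ λ w → CanForce G S used v w) → Chron G S used []
  force : ∀ {S used v w fs} → CanForce G S used v w →
          Chron G (S ∪ ⁅ w ⁆) (v ∷ used) fs → Chron G S used ((v , w) ∷ fs)

ChronList : {n : ℕ} → Graph n → Subset n → List (Fin n × Fin n) → Set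
ChronList G B fs = Chron G B [] fs

-- Cumul G B F t x : x ∈ ⋃_{i ≤ t} F^(i), where F is the set of forces
-- (membership in the list F).
Cumul : {n : ℕ} → Graph n → Subset n → List (Fin n × Fin n) → ℕ → Fin n → Set
Cumul G B F zero    x = x S.∈ B
Cumul G B F (suc t) x =
  Cumul G B F t x ⊎
  (∃ λ v → ((v , x) L.∈ F) × Cumul G B F t v × (¬ Cumul G B F t x) ×
           (∀ u → Adj G v u → Cumul G B F t u))

AllBlueBy : {n : ℕ} → Graph n → Subset n → List (Fin n × Fin n) → ℕ → Set
AllBlueBy G B F t = ∀ x → Cumul G B F t x

-- k is the hopping throttling number of G:
-- k = min over B, sets of forces F of B, and t with ⋃_{i≤t} F^(i) = V,
-- of |B| + t  (this min equals min_B (|B| + pt_H(G;B))).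
IsHopThrottlingNumber : {n : ℕ} → Graph n → ℕ → Set
IsHopThrottlingNumber G k =
  (∃ λ B → ∃ λ F → ∃ λ t → ChronList G B F × AllBlueBy G B F t × (∣ B ∣ + t ≡ k)) ×
  (∀ B F t → ChronList G B F → AllBlueBy G B F t → k ≤ ∣ B ∣ + t)

-- c = ⌈ 2 √ m ⌉ : the least natural number c with 2√m ≤ c, i.e. 4m ≤ c².
IsCeilTwoSqrt : ℕ → ℕ → Set
IsCeilTwoSqrt m c = (4 * m ≤ c * c) × (∀ j → 4 * m ≤ j * j → c ≤ j)

module Submission where

-- Let b = |B| and call a vertex spent after round s if it and all its neighbours are
-- blue by then.  A vertex blue after round s + 1 is in B or is the target of a force
-- whose forcer was spent after round s, and every vertex forces at most once, so at
-- most b + (number of spent vertices) vertices are blue after round s + 1.  While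
-- some vertex is white, connectivity gives a blue vertex with a white neighbour, which
-- is not spent; so each round adds at most b - 1 blue vertices, n ≤ b + t (b - 1),
-- and 4 (n - 1) ≤ 4 (b - 1) (t + 1) ≤ (b + t)² by AM-GM.

open import Defs
open import Data.Nat using (ℕ; zero; suc; _+_; _*_; _∸_; _≤_; _<_; z≤n; s≤s; s≤s⁻¹; _≤?_)
open import Data.Nat.Properties
open import Data.Nat.Tactic.RingSolver using (solve-∀)
open import Data.Fin using (Fin; zero; suc)
open import Data.Fin.Properties as FinP using (all?; any?; ¬∀⟶∃¬) renaming (_≟_ to _≟ᶠ_)
open import Data.Fin.Subset as S using (Subset; inside; outside; ∣_∣; ⁅_⁆)
open import Data.Fin.Subset.Properties
  using (drop-there; nonempty?; Empty-unique; ∣⊥∣≡0; x∈⁅x⁆; p⊆p∪q; q⊆p∪q) renaming (_∈?_ to _∈ₛ?_)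
open import Data.Vec using ([]; _∷_; there)
open import Data.List using (List)
open import Data.List.Membership.Propositional using (_∈_)
open import Data.List.Relation.Unary.Any as Any using ()
import Data.List.Membership.DecPropositional as DecPropositional
open import Data.Product as Product using (∃; ∃₂; _×_; _,_; proj₁; proj₂)
open import Data.Product.Properties using (≡-dec)
open import Data.Sum using (_⊎_; inj₁; inj₂; [_,_]′)
open import Function using (_∘_; case_of_)
open import Relation.Nullary using (¬_; Dec; yes; no; ¬?; _×-dec_; _⊎-dec_; _→-dec_)
open import Relation.Nullary.Decidable using (decidable-stable; ¬¬-excluded-middle)
open import Relation.Nullary.Negation using (¬¬-map; contradiction)
open import Relation.Binary.PropositionalEquality
  using (_≡_; refl; sym; trans; cong; cong₂; subst; subst₂)
open import Relation.Unary using (Decidable)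
open import Algebra.Properties.CommutativeMonoid.Sum +-0-commutativeMonoid
  using (sum; sum-cong-≗; sum-replicate-zero; ∑-distrib-+; ∑-comm)

sum-mono-≤ : ∀ {n} {f g : Fin n → ℕ} → (∀ i → f i ≤ g i) → sum f ≤ sum g
sum-mono-≤ {zero}  f≤g = z≤n
sum-mono-≤ {suc n} f≤g = +-mono-≤ (f≤g zero) (sum-mono-≤ (f≤g ∘ suc))

sum-mono-< : ∀ {n} {f g : Fin n → ℕ} → (∀ i → f i ≤ g i) → ∀ j → f j < g j → sum f < sum g
sum-mono-< f≤g zero    fj<gj = +-mono-<-≤ fj<gj (sum-mono-≤ (f≤g ∘ suc))
sum-mono-< f≤g (suc j) fj<gj = +-mono-≤-< (f≤g zero) (sum-mono-< (f≤g ∘ suc) j fj<gj)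

≤-sum : ∀ {n} (f : Fin n → ℕ) i → f i ≤ sum f
≤-sum f zero    = m≤m+n _ _
≤-sum f (suc i) = ≤-trans (≤-sum (f ∘ suc) i) (m≤n+m _ _)

sum-ones : ∀ n → sum {n} (λ _ → 1) ≡ n
sum-ones zero    = refl
sum-ones (suc n) = cong suc (sum-ones n)

sum-zero : ∀ {n} {f : Fin n → ℕ} → (∀ i → f i ≡ 0) → sum f ≡ 0
sum-zero {n} f≡0 = trans (sum-cong-≗ f≡0) (sum-replicate-zero n)

sum-≤1 : ∀ {n} (f : Fin n → ℕ) → (∀ i → f i ≤ 1) →
         (∀ i j → 0 < f i → 0 < f j → i ≡ j) → sum f ≤ 1
sum-≤1 {zero}  f f≤1 support-unique = z≤n
sum-≤1 {suc n} f f≤1 support-unique with f zero in f0≡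
... | zero  = sum-≤1 (f ∘ suc) (f≤1 ∘ suc) (λ i j p q → FinP.suc-injective (support-unique _ _ p q))
... | suc k = begin
  suc k + sum (f ∘ suc) ≡⟨ cong (suc k +_) (sum-zero tail-zero) ⟩
  suc k + 0             ≡⟨ +-identityʳ _ ⟩
  suc k                 ≡⟨ f0≡ ⟨
  f zero                ≤⟨ f≤1 zero ⟩
  1                     ∎
  where
  open ≤-Reasoning
  tail-zero : ∀ j → f (suc j) ≡ 0
  tail-zero j = n≤0⇒n≡0 (≮⇒≥ λ 0<fj →
    case support-unique zero (suc j) (subst (0 <_) (sym f0≡) (s≤s z≤n)) 0<fj of λ ())

𝟙 : ∀ {a} {A : Set a} → Dec A → ℕ
𝟙 (yes _) = 1
𝟙 (no _)  = 0

module _ {a} {A : Set a} where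

  𝟙≤1 : (d : Dec A) → 𝟙 d ≤ 1
  𝟙≤1 (yes _) = ≤-refl
  𝟙≤1 (no _)  = z≤n

  0<𝟙 : (d : Dec A) → A → 0 < 𝟙 d
  0<𝟙 (yes _) _ = ≤-refl
  0<𝟙 (no ¬a) a = contradiction a ¬a

  0<𝟙⁻¹ : (d : Dec A) → 0 < 𝟙 d → A
  0<𝟙⁻¹ (yes a) _ = a

  𝟙≡0 : (d : Dec A) → ¬ A → 𝟙 d ≡ 0
  𝟙≡0 (yes a) ¬a = contradiction a ¬a
  𝟙≡0 (no _)  _  = refl

  𝟙≤ : ∀ {m} (d : Dec A) → (A → 0 < m) → 𝟙 d ≤ m
  𝟙≤ (yes a) 0<m = 0<m a
  𝟙≤ (no _)  _   = z≤n

module _ {a b} {A : Set a} {B : Set b} where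

  𝟙-mono : (A → B) → (d : Dec A) (e : Dec B) → 𝟙 d ≤ 𝟙 e
  𝟙-mono f d e = 𝟙≤ d (0<𝟙 e ∘ f)

  𝟙-cong : (A → B) → (B → A) → (d : Dec A) (e : Dec B) → 𝟙 d ≡ 𝟙 e
  𝟙-cong f g d e = ≤-antisym (𝟙-mono f d e) (𝟙≤ e (0<𝟙 d ∘ g))

∣p∣≡∑𝟙∈ : ∀ {n} (p : Subset n) → ∣ p ∣ ≡ sum (λ x → 𝟙 (x ∈ₛ? p))
∣p∣≡∑𝟙∈-∷ : ∀ {n} s (p : Subset n) → ∣ p ∣ ≡ sum (λ x → 𝟙 (suc x ∈ₛ? (s ∷ p)))

∣p∣≡∑𝟙∈ []            = refl
∣p∣≡∑𝟙∈ (inside ∷ p)  = cong suc (∣p∣≡∑𝟙∈-∷ inside p)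
∣p∣≡∑𝟙∈ (outside ∷ p) = ∣p∣≡∑𝟙∈-∷ outside p

∣p∣≡∑𝟙∈-∷ s p =
  trans (∣p∣≡∑𝟙∈ p) (sum-cong-≗ λ x → 𝟙-cong there drop-there (x ∈ₛ? p) (suc x ∈ₛ? (s ∷ p)))

¬¬-∀-Fin : ∀ {n p} {P : Fin n → Set p} → (∀ i → ¬ ¬ P i) → ¬ ¬ (∀ i → P i)
¬¬-∀-Fin {zero}  ¬¬P ¬∀P = ¬∀P λ ()
¬¬-∀-Fin {suc n} ¬¬P ¬∀P = ¬¬P zero λ P0 → ¬¬-∀-Fin (¬¬P ∘ suc) λ ∀Psuc →
  ¬∀P λ { zero → P0 ; (suc i) → ∀Psuc i }

4*m*n≤[m+n]² : ∀ m n → 4 * (m * n) ≤ (m + n) * (m + n)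
4*m*n≤[m+n]² m n = [ ordered , flip-ordered ]′ (≤-total m n)
  where
  square-gap : ∀ m d → 4 * (m * (m + d)) + d * d ≡ (m + (m + d)) * (m + (m + d))
  square-gap = solve-∀

  ordered : ∀ {m n} → m ≤ n → 4 * (m * n) ≤ (m + n) * (m + n)
  ordered {m} {n} m≤n = subst (λ n → 4 * (m * n) ≤ (m + n) * (m + n)) (m+[n∸m]≡n m≤n)
    (≤-trans (m≤m+n _ _) (≤-reflexive (square-gap m (n ∸ m))))

  flip-ordered : n ≤ m → 4 * (m * n) ≤ (m + n) * (m + n)
  flip-ordered n≤m =
    subst₂ _≤_ (cong (4 *_) (*-comm n m)) (cong₂ _*_ (+-comm n m) (+-comm n m)) (ordered n≤m)

4*[n∸1]≤[b+t]² : ∀ n b t → n ≤ b + t * (b ∸ 1) → 4 * (n ∸ 1) ≤ (b + t) * (b + t)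
4*[n∸1]≤[b+t]² n zero t n≤t*0 with n≤0⇒n≡0 (≤-trans n≤t*0 (≤-reflexive (*-zeroʳ t)))
... | refl = z≤n
4*[n∸1]≤[b+t]² n (suc b) t n≤1+b+t*b = begin
  4 * (n ∸ 1)                 ≤⟨ *-monoʳ-≤ 4 (∸-monoˡ-≤ 1 n≤1+b+t*b) ⟩
  4 * (b + t * b)             ≡⟨ cong (4 *_) (b+t*b≡b*[1+t] b t) ⟩
  4 * (b * suc t)             ≤⟨ 4*m*n≤[m+n]² b (suc t) ⟩
  (b + suc t) * (b + suc t)   ≡⟨ cong₂ _*_ (+-suc b t) (+-suc b t) ⟩
  (suc b + t) * (suc b + t)   ∎
  where
  open ≤-Reasoning
  b+t*b≡b*[1+t] : ∀ b t → b + t * b ≡ b * suc t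
  b+t*b≡b*[1+t] = solve-∀

_∈ₗ?_ : ∀ {n} (e : Fin n × Fin n) (es : List (Fin n × Fin n)) → Dec (e ∈ es)
_∈ₗ?_ = DecPropositional._∈?_ (≡-dec _≟ᶠ_ _≟ᶠ_)

module _ {n : ℕ} (G : Graph n) where

  walk-leaves : ∀ {P : Fin n → Set} → Decidable P → ∀ {u v} → Walk G u v → P u → ¬ P v →
                ∃₂ λ x y → P x × Adj G x y × ¬ P y
  walk-leaves P? here                   Pu ¬Pv = contradiction Pu ¬Pv
  walk-leaves P? (step {v = w} u~w walk) Pu ¬Pv with P? w
  ... | yes Pw = walk-leaves P? walk Pw ¬Pv
  ... | no ¬Pw = _ , w , Pu , u~w , ¬Pw

  Cumul-mono : ∀ {B F s t x} → s ≤ t → Cumul G B F s x → Cumul G B F t x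
  Cumul-mono {t = zero}  z≤n x∈B = x∈B
  Cumul-mono {t = suc t} s≤1+t blue with m≤n⇒m<n∨m≡n s≤1+t
  ... | inj₁ s<1+t = inj₁ (Cumul-mono (s≤s⁻¹ s<1+t) blue)
  ... | inj₂ refl  = blue

  cumul? : (∀ u v → Dec (Adj G u v)) → ∀ B F t → Decidable (Cumul G B F t)
  cumul? adj? B F zero    x = x ∈ₛ? B
  cumul? adj? B F (suc t) x =
    C? x ⊎-dec any? λ v →
      (v , x) ∈ₗ? F ×-dec C? v ×-dec ¬? (C? x) ×-dec all? λ u → adj? v u →-dec C? u
    where C? = cumul? adj? B F t

  forced-fresh : ∀ {S used fs} → Chron G S used fs →
                 ∀ {v x} → (v , x) ∈ fs → x S.∉ S × ¬ v ∈ used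
  forced-fresh (done _) ()
  forced-fresh (force (_ , x∉S , v∉used , _) _) (Any.here refl) = x∉S , v∉used
  forced-fresh (force {w = w} _ rest) (Any.there v→x) =
    Product.map (_∘ p⊆p∪q ⁅ w ⁆) (_∘ Any.there) (forced-fresh rest v→x)

  forces-functional : ∀ {S used fs} → Chron G S used fs →
                      ∀ {v x y} → (v , x) ∈ fs → (v , y) ∈ fs → x ≡ y
  forces-functional (force _ _)    (Any.here refl)  (Any.here refl)  = refl
  forces-functional (force _ rest) (Any.here refl)  (Any.there v→y)  =
    contradiction (Any.here refl) (proj₂ (forced-fresh rest v→y))
  forces-functional (force _ rest) (Any.there v→x)  (Any.here refl)  =
    contradiction (Any.here refl) (proj₂ (forced-fresh rest v→x))
  forces-functional (force _ rest) (Any.there v→x)  (Any.there v→y)  =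
    forces-functional rest v→x v→y

  forces-injective : ∀ {S used fs} → Chron G S used fs →
                     ∀ {u v x} → (u , x) ∈ fs → (v , x) ∈ fs → u ≡ v
  forces-injective (force _ _)    (Any.here refl)  (Any.here refl)  = refl
  forces-injective (force _ rest) (Any.here refl)  (Any.there v→x)  =
    contradiction (q⊆p∪q _ ⁅ _ ⁆ (x∈⁅x⁆ _)) (proj₁ (forced-fresh rest v→x))
  forces-injective (force _ rest) (Any.there u→x)  (Any.here refl)  =
    contradiction (q⊆p∪q _ ⁅ _ ⁆ (x∈⁅x⁆ _)) (proj₁ (forced-fresh rest u→x))
  forces-injective (force _ rest) (Any.there u→x)  (Any.there v→x)  =
    forces-injective rest u→x v→x

module Counting {n : ℕ} (G : Graph n) (connected : Connected G) (B : Subset n)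
                (F : List (Fin n × Fin n)) (chron : ChronList G B F)
                (adj? : ∀ u v → Dec (Adj G u v)) where

  open ≤-Reasoning

  C : ℕ → Fin n → Set
  C = Cumul G B F

  C? : ∀ s → Decidable (C s)
  C? = cumul? G adj? B F

  Spent : ℕ → Fin n → Set
  Spent s v = C s v × (∀ u → Adj G v u → C s u)

  spent? : ∀ s → Decidable (Spent s)
  spent? s v = C? s v ×-dec all? λ u → adj? v u →-dec C? s u

  blue spent : ℕ → ℕ
  blue  s = sum λ x → 𝟙 (C? s x)
  spent s = sum λ v → 𝟙 (spent? s v)

  forcer-spent : ∀ s {v x} → C (suc s) x → (v , x) ∈ F → Spent s v
  forcer-spent s (inj₂ (u , u→x , Cu , _ , N[u]-blue)) v→x with forces-injective G chron u→x v→x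
  ... | refl = Cu , N[u]-blue
  forcer-spent zero    (inj₁ x∈B) v→x = contradiction x∈B (proj₁ (forced-fresh G chron v→x))
  forcer-spent (suc s) (inj₁ Cx)  v→x =
    Product.map inj₁ (λ N[v]-blue u → inj₁ ∘ N[v]-blue u) (forcer-spent s Cx v→x)

  initial-or-forced : ∀ s {x} → C s x → x S.∈ B ⊎ ∃ λ v → (v , x) ∈ F
  initial-or-forced zero    x∈B                 = inj₁ x∈B
  initial-or-forced (suc s) (inj₁ Cx)           = initial-or-forced s Cx
  initial-or-forced (suc s) (inj₂ (v , v→x , _)) = inj₂ (v , v→x)

  forced? : ∀ s v x → Dec ((v , x) ∈ F × C (suc s) x)
  forced? s v x = (v , x) ∈ₗ? F ×-dec C? (suc s) x

  blue-suc-pointwise : ∀ s x → 𝟙 (C? (suc s) x) ≤ 𝟙 (x ∈ₛ? B) + sum (λ v → 𝟙 (forced? s v x))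
  blue-suc-pointwise s x = 𝟙≤ (C? (suc s) x) bound
    where
    bound : C (suc s) x → 0 < 𝟙 (x ∈ₛ? B) + sum (λ v → 𝟙 (forced? s v x))
    bound Cx with initial-or-forced (suc s) Cx
    ... | inj₁ x∈B       = ≤-trans (0<𝟙 (x ∈ₛ? B) x∈B) (m≤m+n _ _)
    ... | inj₂ (v , v→x) =
      ≤-trans (0<𝟙 (forced? s v x) (v→x , Cx)) (≤-trans (≤-sum _ v) (m≤n+m _ _))

  forced-by-≤-spent : ∀ s v → sum (λ x → 𝟙 (forced? s v x)) ≤ 𝟙 (spent? s v)
  forced-by-≤-spent s v with spent? s v
  ... | yes _ = sum-≤1 _ (λ x → 𝟙≤1 (forced? s v x)) λ x y forces-x forces-y →
    forces-functional G chron (proj₁ (0<𝟙⁻¹ (forced? s v x) forces-x))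
                              (proj₁ (0<𝟙⁻¹ (forced? s v y) forces-y))
  ... | no ¬spent = ≤-reflexive (sum-zero λ x → 𝟙≡0 (forced? s v x) λ (v→x , Cx) →
    ¬spent (forcer-spent s Cx v→x))

  blue-suc-≤ : ∀ s → blue (suc s) ≤ ∣ B ∣ + spent s
  blue-suc-≤ s = begin
    blue (suc s)
      ≤⟨ sum-mono-≤ (blue-suc-pointwise s) ⟩
    sum (λ x → 𝟙 (x ∈ₛ? B) + sum λ v → 𝟙 (forced? s v x))
      ≡⟨ ∑-distrib-+ (λ x → 𝟙 (x ∈ₛ? B)) _ ⟩
    sum (λ x → 𝟙 (x ∈ₛ? B)) + sum (λ x → sum λ v → 𝟙 (forced? s v x))
      ≡⟨ cong₂ _+_ (∣p∣≡∑𝟙∈ B) (∑-comm λ v x → 𝟙 (forced? s v x)) ⟨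
    ∣ B ∣ + sum (λ v → sum λ x → 𝟙 (forced? s v x))
      ≤⟨ +-monoʳ-≤ ∣ B ∣ (sum-mono-≤ (forced-by-≤-spent s)) ⟩
    ∣ B ∣ + spent s
      ∎

  spent≤blue-pointwise : ∀ s v → 𝟙 (spent? s v) ≤ 𝟙 (C? s v)
  spent≤blue-pointwise s v = 𝟙-mono proj₁ (spent? s v) (C? s v)

  spent<blue : ∀ s {y x} → C s y → ¬ C s x → spent s < blue s
  spent<blue s Cy ¬Cx with walk-leaves G (C? s) (connected _ _) Cy ¬Cx
  ... | u , w , Cu , u~w , ¬Cw = sum-mono-< (spent≤blue-pointwise s) u (begin-strict
    𝟙 (spent? s u) ≡⟨ 𝟙≡0 (spent? s u) (λ (_ , N[u]-blue) → ¬Cw (N[u]-blue w u~w)) ⟩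
    0              <⟨ 0<𝟙 (C? s u) Cu ⟩
    𝟙 (C? s u)     ∎)

  blue-step : ∀ s → blue (suc s) ≤ blue s + (∣ B ∣ ∸ 1)
  blue-step s with all? (C? s)
  ... | yes all-blue =
    ≤-trans (sum-mono-≤ λ x → 𝟙-mono (λ _ → all-blue x) (C? (suc s) x) (C? s x)) (m≤m+n _ _)
  ... | no ¬all-blue with ¬∀⟶∃¬ n (C s) (C? s) ¬all-blue | nonempty? B
  ...   | x , ¬Cx | yes (y , y∈B) = begin
    blue (suc s)                ≤⟨ blue-suc-≤ s ⟩
    ∣ B ∣ + spent s             ≤⟨ +-monoˡ-≤ (spent s) (m≤n+m∸n ∣ B ∣ 1) ⟩
    suc (∣ B ∣ ∸ 1) + spent s   ≡⟨ +-suc (∣ B ∣ ∸ 1) (spent s) ⟨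
    (∣ B ∣ ∸ 1) + suc (spent s) ≤⟨ +-monoʳ-≤ (∣ B ∣ ∸ 1) (spent<blue s (Cumul-mono G z≤n y∈B) ¬Cx) ⟩
    (∣ B ∣ ∸ 1) + blue s        ≡⟨ +-comm (∣ B ∣ ∸ 1) (blue s) ⟩
    blue s + (∣ B ∣ ∸ 1)        ∎
  ...   | _ | no B-empty = begin
    blue (suc s)                ≤⟨ blue-suc-≤ s ⟩
    ∣ B ∣ + spent s             ≡⟨ cong (_+ spent s) (trans (cong ∣_∣ (Empty-unique B-empty)) (∣⊥∣≡0 n)) ⟩
    spent s                     ≤⟨ sum-mono-≤ (spent≤blue-pointwise s) ⟩
    blue s                      ≤⟨ m≤m+n _ _ ⟩
    blue s + (∣ B ∣ ∸ 1)        ∎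

  blue-≤ : ∀ s → blue s ≤ ∣ B ∣ + s * (∣ B ∣ ∸ 1)
  blue-≤ zero    = ≤-reflexive (trans (sym (∣p∣≡∑𝟙∈ B)) (sym (+-identityʳ _)))
  blue-≤ (suc s) = begin
    blue (suc s)                               ≤⟨ blue-step s ⟩
    blue s + (∣ B ∣ ∸ 1)                       ≤⟨ +-monoˡ-≤ (∣ B ∣ ∸ 1) (blue-≤ s) ⟩
    ∣ B ∣ + s * (∣ B ∣ ∸ 1) + (∣ B ∣ ∸ 1)       ≡⟨ +-assoc ∣ B ∣ _ _ ⟩
    ∣ B ∣ + (s * (∣ B ∣ ∸ 1) + (∣ B ∣ ∸ 1))     ≡⟨ cong (∣ B ∣ +_) (+-comm _ (∣ B ∣ ∸ 1)) ⟩
    ∣ B ∣ + suc s * (∣ B ∣ ∸ 1)                 ∎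

  n≤∣B∣+t*[∣B∣∸1] : ∀ t → AllBlueBy G B F t → n ≤ ∣ B ∣ + t * (∣ B ∣ ∸ 1)
  n≤∣B∣+t*[∣B∣∸1] t all-blue = begin
    n                        ≡⟨ sum-ones n ⟨
    sum {n} (λ _ → 1)        ≤⟨ sum-mono-≤ (λ x → 0<𝟙 (C? t x) (all-blue x)) ⟩
    blue t                   ≤⟨ blue-≤ t ⟩
    ∣ B ∣ + t * (∣ B ∣ ∸ 1)  ∎

corollary3p3 : (n : ℕ) (G : Graph n) → Connected G →
    (k : ℕ) → IsHopThrottlingNumber G k →
    (c : ℕ) → IsCeilTwoSqrt (n ∸ 1) c → c ≤ k
corollary3p3 n G connected k ((B , F , t , chron , all-blue , ∣B∣+t≡k) , _) c (_ , c-least) =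
  subst (c ≤_) ∣B∣+t≡k (c-least (∣ B ∣ + t)
    (decidable-stable (_ ≤? _) (¬¬-map square-bound adjacency-decidable)))
  where
  -- Counting needs decidable adjacency, which holds classically; the goal is decidable.
  adjacency-decidable : ¬ ¬ (∀ u v → Dec (Adj G u v))
  adjacency-decidable = ¬¬-∀-Fin λ u → ¬¬-∀-Fin λ v → ¬¬-excluded-middle

  square-bound : (∀ u v → Dec (Adj G u v)) → 4 * (n ∸ 1) ≤ (∣ B ∣ + t) * (∣ B ∣ + t)
  square-bound adj? =
    4*[n∸1]≤[b+t]² n ∣ B ∣ t (Counting.n≤∣B∣+t*[∣B∣∸1] G connected B F chron adj? t all-blue)
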